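{- Define generalized harmonic numbers $H_n^{(k)}$ ($n\ge1$, $k\ge0$) by $H_n^{(0)}=1$ and $H_n^{(k)}=\sum_{j=1}^{n}H_j^{(k-1)}/j$ for $k\ge1$. Then for every positive integer $k$, $$\sum_{j=1}^{\infty}\frac{(-1)^{j-1}}{j^{k}}=\sum_{n=1}^{\infty}\frac{H_{n}^{(k-1)}}{n\,2^{n}},$$ and consequently, for every integer $k\ge2$, the Riemann zeta function satisfies $$\zeta(k)=\frac{2^{k-1}}{2^{k-1}-1}\sum_{n=1}^{\infty}\frac{H_{n}^{(k-1)}}{n\,2^{n}}.$$
   Context: $\zeta(k)=\sum_{j=1}^\infty j^{ -k}$. -}

module Defs where

open import Data.Nat as ℕ using (ℕ; zero; suc; _∸_; _^_)
open import Data.Integer as ℤ using (ℤ; +_)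
open import Data.Rational using (ℚ; 0ℚ; 1ℚ; _+_; _*_; _-_; -_; _/_; ∣_∣; _<_)
open import Data.Product using (∃-syntax)

qpow : ℚ → ℕ → ℚ
qpow x zero    = 1ℚ
qpow x (suc k) = qpow x k * x

-- recip j = 1 / j  (only ever used for j ≥ 1; the value at 0 is irrelevant)
recip : ℕ → ℚ
recip zero    = 0ℚ
recip (suc n) = (+ 1) / suc n

sum1 : ℕ → (ℕ → ℚ) → ℚ
sum1 zero    f = 0ℚ
sum1 (suc N) f = sum1 N f + f (suc N)

H : ℕ → ℕ → ℚ
H zero    n = 1ℚ
H (suc k) n = sum1 n (λ j → H k j * recip j)

altPartial : ℕ → ℕ → ℚ
altPartial k N = sum1 N (λ j → qpow (- 1ℚ) (j ∸ 1) * qpow (recip j) k)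

zetaPartial : ℕ → ℕ → ℚ
zetaPartial k N = sum1 N (λ j → qpow (recip j) k)

hPartial : ℕ → ℕ → ℚ
hPartial k N = sum1 N (λ n → H (k ∸ 1) n * recip n * qpow ((+ 1) / 2) n)

-- the constant 2^(k-1) / (2^(k-1) - 1), written for k ≥ 2 with
-- denominator suc (2^(k-1) ∸ 2) = 2^(k-1) - 1
zetaConst : ℕ → ℚ
zetaConst k = (+ (2 ^ (k ∸ 1))) / suc (2 ^ (k ∸ 1) ∸ 2)

-- Two real series with rational partial sums a, b both converge and have the
-- same sum  ⇔  for every ε > 0 there is N with |a m - b n| < ε for all m, n ≥ N.
SameLimit : (ℕ → ℚ) → (ℕ → ℚ) → Set
SameLimit a b = (ε : ℚ) → 0ℚ < ε →
  ∃[ N ] ((m n : ℕ) → N ℕ.≤ m → N ℕ.≤ n → ∣ a m - b n ∣ < ε)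

module Submission where

-- For a series Σ α i write A N = Σ_{i<N} α i, b m = Σ_{i≤m} C(m,i) α i and
-- B N = Σ_{m<N} b m / 2^(m+1) (Euler's transform). For EVERY α,
--     2^N (A N - B N) = Σ_{i≤N} C(N,i) (A N - A i),
-- so if |A n - A i| ≤ 1/(i+1) for i ≤ n, then |A N - B N| ≤ 2/(N+1), since
-- Σ_{i≤N} C(N,i)/(i+1) ≤ 2^(N+1)/(N+1).  Leibniz's estimate gives that
-- hypothesis for α i = (-1)^i/(i+1)^k, k ≥ 1.  By Pascal's rule and the
-- absorption identity, H_n^(k-1) = Σ_{i<n} C(n,i+1) (-1)^i/(i+1)^(k-1), whence
-- H_n^(k-1)/n = b (n-1) and hPartial k is exactly B.  For ζ(k), k ≥ 2, the
-- doubling identity Z(2n) = A(2n) + 2^(1-k) Z n and the telescoping tail bound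
-- |Z n - Z i| ≤ 2/(i+1) express Z m - c·B n through four controlled errors.
-- All estimates are explicit rates c/(N+1), and SameLimit follows by the
-- Archimedean property.

open import Defs
open import Data.Nat using (ℕ; _≤_)
open import Data.Rational using (_*_)
open import Data.Product using (_×_)

open import Data.Nat as ℕ using (zero; suc; _∸_; _^_; z≤n; s≤s)
import Data.Nat.Properties as ℕP
import Data.Integer as ℤ
import Data.Integer.Properties as ℤP
import Data.Integer.Solver as ℤSolver
open import Data.Rational as ℚ using (ℚ; 0ℚ; 1ℚ; _+_; _-_; -_; _/_; ∣_∣; _<_; mkℚ)
import Data.Rational.Properties as ℚP
import Data.Rational.Unnormalised as ℚᵘ
import Data.Rational.Unnormalised.Properties as ℚᵘP
import Data.Nat.Coprimality as Coprime
open import Data.Rational.Solver using (module +-*-Solver)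
open import Data.Product using (_,_; proj₁; proj₂; ∃-syntax)
open import Data.Sum using (inj₁; inj₂)
open import Relation.Binary.PropositionalEquality

∑ : ℕ → (ℕ → ℚ) → ℚ
∑ zero    f = 0ℚ
∑ (suc n) f = ∑ n f + f n

sum1≡∑ : ∀ N f → sum1 N f ≡ ∑ N (λ i → f (suc i))
sum1≡∑ zero    f = refl
sum1≡∑ (suc N) f = cong (_+ f (suc N)) (sum1≡∑ N f)

∑-cong : ∀ n {f g : ℕ → ℚ} → (∀ i → f i ≡ g i) → ∑ n f ≡ ∑ n g
∑-cong zero    eq = refl
∑-cong (suc n) eq = cong₂ _+_ (∑-cong n eq) (eq n)

∑-+ : ∀ n (f g : ℕ → ℚ) → ∑ n (λ i → f i + g i) ≡ ∑ n f + ∑ n g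
∑-+ zero    f g = refl
∑-+ (suc n) f g = trans (cong (_+ (f n + g n)) (∑-+ n f g)) (interchange (∑ n f) (∑ n g) (f n) (g n))
  where
  open +-*-Solver
  interchange : ∀ a b c d → (a + b) + (c + d) ≡ (a + c) + (b + d)
  interchange = solve 4 (λ a b c d → (a :+ b) :+ (c :+ d) := (a :+ c) :+ (b :+ d)) refl

∑-neg : ∀ n (f : ℕ → ℚ) → ∑ n (λ i → - f i) ≡ - ∑ n f
∑-neg zero    f = refl
∑-neg (suc n) f = trans (cong (_+ (- f n)) (∑-neg n f)) (sym (ℚP.neg-distrib-+ (∑ n f) (f n)))

∑-*ˡ : ∀ n (c : ℚ) (f : ℕ → ℚ) → c * ∑ n f ≡ ∑ n (λ i → c * f i)
∑-*ˡ zero    c f = ℚP.*-zeroʳ c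
∑-*ˡ (suc n) c f = trans (ℚP.*-distribˡ-+ c (∑ n f) (f n)) (cong (_+ c * f n) (∑-*ˡ n c f))

∑-*ʳ : ∀ n (c : ℚ) (f : ℕ → ℚ) → ∑ n f * c ≡ ∑ n (λ i → f i * c)
∑-*ʳ n c f = trans (ℚP.*-comm (∑ n f) c) (trans (∑-*ˡ n c f) (∑-cong n (λ i → ℚP.*-comm c (f i))))

∑-first : ∀ n (f : ℕ → ℚ) → ∑ (suc n) f ≡ f 0 + ∑ n (λ i → f (suc i))
∑-first zero    f = trans (ℚP.+-identityˡ (f 0)) (sym (ℚP.+-identityʳ (f 0)))
∑-first (suc n) f = trans (cong (_+ f (suc n)) (∑-first n f)) (ℚP.+-assoc (f 0) _ _)

∑-split : ∀ m d (f : ℕ → ℚ) → ∑ (m ℕ.+ d) f ≡ ∑ m f + ∑ d (λ t → f (m ℕ.+ t))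
∑-split m zero    f rewrite ℕP.+-identityʳ m = sym (ℚP.+-identityʳ (∑ m f))
∑-split m (suc d) f rewrite ℕP.+-suc m d =
  trans (cong (_+ f (m ℕ.+ d)) (∑-split m d f)) (ℚP.+-assoc (∑ m f) _ _)

∑-increment : ∀ m d (f : ℕ → ℚ) → ∑ (m ℕ.+ d) f - ∑ m f ≡ ∑ d (λ t → f (m ℕ.+ t))
∑-increment m d f = trans (cong (_- ∑ m f) (∑-split m d f)) (cancel (∑ m f) _)
  where
  open +-*-Solver
  cancel : ∀ a x → (a + x) - a ≡ x
  cancel = solve 2 (λ a x → (a :+ x) :- a := x) refl

∑-telescope : ∀ d (f : ℕ → ℚ) → ∑ d (λ t → f t - f (suc t)) ≡ f 0 - f d
∑-telescope zero    f = sym (ℚP.+-inverseʳ (f 0))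
∑-telescope (suc d) f = trans (cong (_+ (f d - f (suc d))) (∑-telescope d f)) (chain (f 0) (f d) (f (suc d)))
  where
  open +-*-Solver
  chain : ∀ a b c → (a - b) + (b - c) ≡ a - c
  chain = solve 3 (λ a b c → (a :- b) :+ (b :- c) := a :- c) refl

∑-mono : ∀ n {f g : ℕ → ℚ} → (∀ i → i ℕ.< n → f i ℚ.≤ g i) → ∑ n f ℚ.≤ ∑ n g
∑-mono zero    le = ℚP.≤-refl
∑-mono (suc n) le = ℚP.+-mono-≤ (∑-mono n (λ i i<n → le i (ℕP.m<n⇒m<1+n i<n))) (le n ℕP.≤-refl)

∑-nonneg : ∀ n (f : ℕ → ℚ) → (∀ i → 0ℚ ℚ.≤ f i) → 0ℚ ℚ.≤ ∑ n f
∑-nonneg n f f≥0 = subst (ℚ._≤ ∑ n f) (∑-zero n) (∑-mono n (λ i _ → f≥0 i))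
  where
  ∑-zero : ∀ n → ∑ n (λ _ → 0ℚ) ≡ 0ℚ
  ∑-zero zero    = refl
  ∑-zero (suc n) = trans (ℚP.+-identityʳ _) (∑-zero n)

∣∑∣≤∑∣∣ : ∀ n (f : ℕ → ℚ) → ∣ ∑ n f ∣ ℚ.≤ ∑ n (λ i → ∣ f i ∣)
∣∑∣≤∑∣∣ zero    f = ℚP.≤-refl
∣∑∣≤∑∣∣ (suc n) f = ℚP.≤-trans (ℚP.∣p+q∣≤∣p∣+∣q∣ (∑ n f) (f n)) (ℚP.+-monoˡ-≤ ∣ f n ∣ (∣∑∣≤∑∣∣ n f))

ι : ℕ → ℚ
ι zero    = 0ℚ
ι (suc n) = ι n + 1ℚ

ι-normal : ℕ → ℚ
ι-normal n = mkℚ (ℤ.+ n) 0 (Coprime.sym (Coprime.1-coprimeTo n))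

ι≡ι-normal : ∀ n → ι n ≡ ι-normal n
ι≡ι-normal zero    = refl
ι≡ι-normal (suc n) = trans (cong (_+ 1ℚ) (ι≡ι-normal n)) (sym normal-suc)
  where
  open ℤSolver.+-*-Solver
  numerators : (ℤ.+ 1 ℤ.+ ℤ.+ n) ℤ.* ℤ.+ 1 ≡ (ℤ.+ n ℤ.* ℤ.+ 1 ℤ.+ ℤ.+ 1 ℤ.* ℤ.+ 1) ℤ.* ℤ.+ 1
  numerators = solve 1 (λ x → (con (ℤ.+ 1) :+ x) :* con (ℤ.+ 1)
                           := (x :* con (ℤ.+ 1) :+ con (ℤ.+ 1) :* con (ℤ.+ 1)) :* con (ℤ.+ 1)) refl (ℤ.+ n)
  normal-suc : ι-normal (suc n) ≡ ι-normal n + 1ℚ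
  normal-suc = ℚP.toℚᵘ-injective
    (ℚᵘP.≃-trans (ℚᵘ.*≡* numerators) (ℚᵘP.≃-sym (ℚP.toℚᵘ-homo-+ (ι-normal n) 1ℚ)))

recip≡1/ : ∀ n → recip (suc n) ≡ ℚ.1/ (ι-normal (suc n))
recip≡1/ n = ℚP.normalize-coprime (Coprime.1-coprimeTo (suc n))

recip-inverse : ∀ n → recip (suc n) * ι (suc n) ≡ 1ℚ
recip-inverse n rewrite recip≡1/ n | ι≡ι-normal (suc n) = ℚP.*-inverseˡ (ι-normal (suc n))

ι-+ : ∀ m n → ι (m ℕ.+ n) ≡ ι m + ι n
ι-+ zero    n = sym (ℚP.+-identityˡ (ι n))
ι-+ (suc m) n = trans (cong (_+ 1ℚ) (ι-+ m n)) (shift (ι m) (ι n))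
  where
  open +-*-Solver
  shift : ∀ a b → (a + b) + 1ℚ ≡ (a + 1ℚ) + b
  shift = solve 2 (λ a b → (a :+ b) :+ con 1ℚ := (a :+ con 1ℚ) :+ b) refl

ι-* : ∀ m n → ι (m ℕ.* n) ≡ ι m * ι n
ι-* zero    n = sym (ℚP.*-zeroˡ (ι n))
ι-* (suc m) n = trans (ι-+ n (m ℕ.* n)) (trans (cong (_+_ (ι n)) (ι-* m n)) (distrib (ι m) (ι n)))
  where
  open +-*-Solver
  distrib : ∀ a b → b + a * b ≡ (a + 1ℚ) * b
  distrib = solve 2 (λ a b → b :+ a :* b := (a :+ con 1ℚ) :* b) refl

ι-nonneg : ∀ n → 0ℚ ℚ.≤ ι n
ι-nonneg zero    = ℚP.≤-refl
ι-nonneg (suc n) = ℚP.≤-trans (ι-nonneg n)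
  (subst (ℚ._≤ ι n + 1ℚ) (ℚP.+-identityʳ (ι n)) (ℚP.+-monoʳ-≤ (ι n) (ℚ.*≤* (ℤ.+≤+ z≤n))))

ι*recip≃ : ∀ a d → ℚ.toℚᵘ (ι a * recip (suc d)) ℚᵘ.≃ ℚᵘ.mkℚᵘ (ℤ.+ a) d
ι*recip≃ a d rewrite ι≡ι-normal a | recip≡1/ d =
  ℚᵘP.≃-trans (ℚP.toℚᵘ-homo-* (ι-normal a) (ℚ.1/ ι-normal (suc d))) (ℚᵘ.*≡* cross)
  where
  open ℤSolver.+-*-Solver
  cross : (ℤ.+ a ℤ.* ℤ.+ 1) ℤ.* ℤ.+ suc d ≡ ℤ.+ a ℤ.* (ℤ.+ 1 ℤ.* ℤ.+ suc d)
  cross = solve 2 (λ x y → (x :* con (ℤ.+ 1)) :* y := x :* (con (ℤ.+ 1) :* y)) refl (ℤ.+ a) (ℤ.+ suc d)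

/≡ι*recip : ∀ a d → (ℤ.+ a) / suc d ≡ ι a * recip (suc d)
/≡ι*recip a d = ℚP.toℚᵘ-injective
  (ℚᵘP.≃-trans (ℚP.toℚᵘ-fromℚᵘ (ℚᵘ.mkℚᵘ (ℤ.+ a) d)) (ℚᵘP.≃-sym (ι*recip≃ a d)))

fraction-≤ : ∀ a b m n → a ℕ.* suc n ℕ.≤ b ℕ.* suc m → ι a * recip (suc m) ℚ.≤ ι b * recip (suc n)
fraction-≤ a b m n le = ℚP.toℚᵘ-cancel-≤
  (ℚᵘP.≤-respˡ-≃ (ℚᵘP.≃-sym (ι*recip≃ a m)) (ℚᵘP.≤-respʳ-≃ (ℚᵘP.≃-sym (ι*recip≃ b n))
    (ℚᵘ.*≤* (subst₂ ℤ._≤_ (ℤP.pos-* a (suc n)) (ℤP.pos-* b (suc m)) (ℤ.+≤+ le)))))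

fraction-< : ∀ a b m n → a ℕ.* suc n ℕ.< b ℕ.* suc m → ι a * recip (suc m) < ι b * recip (suc n)
fraction-< a b m n lt = ℚP.toℚᵘ-cancel-<
  (ℚᵘP.<-respˡ-≃ (ℚᵘP.≃-sym (ι*recip≃ a m)) (ℚᵘP.<-respʳ-≃ (ℚᵘP.≃-sym (ι*recip≃ b n))
    (ℚᵘ.*<* (subst₂ ℤ._<_ (ℤP.pos-* a (suc n)) (ℤP.pos-* b (suc m)) (ℤ.+<+ lt)))))

recip≡1*recip : ∀ n → recip (suc n) ≡ ι 1 * recip (suc n)
recip≡1*recip n = sym (ℚP.*-identityˡ (recip (suc n)))

recip-antitone : ∀ m n → m ℕ.≤ n → recip (suc n) ℚ.≤ recip (suc m)
recip-antitone m n le = subst₂ ℚ._≤_ (sym (recip≡1*recip n)) (sym (recip≡1*recip m))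
  (fraction-≤ 1 1 n m (subst₂ ℕ._≤_ (sym (ℕP.*-identityˡ (suc m))) (sym (ℕP.*-identityˡ (suc n))) (s≤s le)))

recip-nonneg : ∀ n → 0ℚ ℚ.≤ recip n
recip-nonneg zero    = ℚP.≤-refl
recip-nonneg (suc n) = subst₂ ℚ._≤_ (ℚP.*-zeroˡ (recip (suc n))) (sym (recip≡1*recip n)) (fraction-≤ 0 1 n n z≤n)

recip-≤1 : ∀ n → recip (suc n) ℚ.≤ 1ℚ
recip-≤1 n = recip-antitone 0 n z≤n

recip-difference : ∀ j → recip (suc j) - recip (suc (suc j)) ≡ recip (suc j) * recip (suc (suc j))
recip-difference j = sym (begin
    r * r'
  ≡⟨ sym (ℚP.*-identityʳ _) ⟩
    r * r' * 1ℚ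
  ≡⟨ cong (r * r' *_) (sym (succ-minus p)) ⟩
    r * r' * ((p + 1ℚ) - p)
  ≡⟨ expand r r' p ⟩
    (r' * (p + 1ℚ)) * r - (r * p) * r'
  ≡⟨ cong₂ (λ u v → u * r - v * r') (recip-inverse (suc j)) (recip-inverse j) ⟩
    1ℚ * r - 1ℚ * r'
  ≡⟨ cong₂ _-_ (ℚP.*-identityˡ r) (ℚP.*-identityˡ r') ⟩
    r - r'
  ∎)
  where
  open ≡-Reasoning
  open +-*-Solver
  r  = recip (suc j)
  r' = recip (suc (suc j))
  p  = ι (suc j)
  succ-minus : ∀ p → (p + 1ℚ) - p ≡ 1ℚ
  succ-minus = solve 1 (λ p → (p :+ con 1ℚ) :- p := con 1ℚ) refl
  expand : ∀ r r' p → r * r' * ((p + 1ℚ) - p) ≡ (r' * (p + 1ℚ)) * r - (r * p) * r'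
  expand = solve 3 (λ r r' p → r :* r' :* ((p :+ con 1ℚ) :- p) := (r' :* (p :+ con 1ℚ)) :* r :- (r :* p) :* r') refl

0≤1 : 0ℚ ℚ.≤ 1ℚ
0≤1 = ℚ.*≤* (ℤ.+≤+ z≤n)

0≤q-p : ∀ {p q} → p ℚ.≤ q → 0ℚ ℚ.≤ q - p
0≤q-p {p} {q} le = subst (ℚ._≤ q - p) (ℚP.+-inverseʳ p) (ℚP.+-monoˡ-≤ (- p) le)

q-p≤q : ∀ {p} q → 0ℚ ℚ.≤ p → q - p ℚ.≤ q
q-p≤q {p} q p≥0 = subst (q - p ℚ.≤_) (ℚP.+-identityʳ q) (ℚP.+-monoʳ-≤ q (ℚP.neg-antimono-≤ p≥0))

p≤q+p : ∀ {p} q → 0ℚ ℚ.≤ q → p ℚ.≤ q + p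
p≤q+p {p} q q≥0 = subst (ℚ._≤ q + p) (ℚP.+-identityˡ p) (ℚP.+-monoˡ-≤ p q≥0)

*-mono-≤-nonneg : ∀ {a b c d} → 0ℚ ℚ.≤ a → 0ℚ ℚ.≤ c → a ℚ.≤ b → c ℚ.≤ d → a * c ℚ.≤ b * d
*-mono-≤-nonneg {a} {b} {c} {d} a≥0 c≥0 a≤b c≤d =
  ℚP.≤-trans (ℚP.*-monoʳ-≤-nonNeg c {{ℚ.nonNegative c≥0}} a≤b)
             (ℚP.*-monoˡ-≤-nonNeg b {{ℚ.nonNegative (ℚP.≤-trans a≥0 a≤b)}} c≤d)

*-nonneg : ∀ {a b} → 0ℚ ℚ.≤ a → 0ℚ ℚ.≤ b → 0ℚ ℚ.≤ a * b
*-nonneg {a} {b} a≥0 b≥0 = subst (ℚ._≤ a * b) (ℚP.*-zeroˡ 0ℚ) (*-mono-≤-nonneg ℚP.≤-refl ℚP.≤-refl a≥0 b≥0)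

∣c*x∣≤c*bound : ∀ {c x b} → 0ℚ ℚ.≤ c → ∣ x ∣ ℚ.≤ b → ∣ c * x ∣ ℚ.≤ c * b
∣c*x∣≤c*bound {c} {x} c≥0 le =
  subst (ℚ._≤ c * _) (sym (trans (ℚP.∣p*q∣≡∣p∣*∣q∣ c x) (cong (_* ∣ x ∣) (ℚP.0≤p⇒∣p∣≡p c≥0))))
    (ℚP.*-monoˡ-≤-nonNeg c {{ℚ.nonNegative c≥0}} le)

∣p-q∣≡∣q-p∣ : ∀ p q → ∣ p - q ∣ ≡ ∣ q - p ∣
∣p-q∣≡∣q-p∣ p q = trans (sym (ℚP.∣-p∣≡∣p∣ (p - q))) (cong ∣_∣ (negate-difference p q))
  where
  open +-*-Solver
  negate-difference : ∀ p q → - (p - q) ≡ q - p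
  negate-difference = solve 2 (λ p q → :- (p :- q) := q :- p) refl

∣a+b+c+d∣≤ : ∀ a b c d → ∣ a + b + c + d ∣ ℚ.≤ ∣ a ∣ + ∣ b ∣ + ∣ c ∣ + ∣ d ∣
∣a+b+c+d∣≤ a b c d = ℚP.≤-trans (ℚP.∣p+q∣≤∣p∣+∣q∣ (a + b + c) d) (ℚP.+-monoˡ-≤ ∣ d ∣
  (ℚP.≤-trans (ℚP.∣p+q∣≤∣p∣+∣q∣ (a + b) c) (ℚP.+-monoˡ-≤ ∣ c ∣ (ℚP.∣p+q∣≤∣p∣+∣q∣ a b))))

two half : ℚ
two  = 1ℚ + 1ℚ
half = (ℤ.+ 1) / 2

half*two : half * two ≡ 1ℚ
half*two = refl

qpow-+ : ∀ x m n → qpow x (m ℕ.+ n) ≡ qpow x m * qpow x n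
qpow-+ x m zero    rewrite ℕP.+-identityʳ m = sym (ℚP.*-identityʳ _)
qpow-+ x m (suc n) rewrite ℕP.+-suc m n =
  trans (cong (_* x) (qpow-+ x m n)) (ℚP.*-assoc (qpow x m) _ _)

qpow-* : ∀ x y n → qpow (x * y) n ≡ qpow x n * qpow y n
qpow-* x y zero    = refl
qpow-* x y (suc n) = trans (cong (_* (x * y)) (qpow-* x y n)) (interchange (qpow x n) (qpow y n) x y)
  where
  open +-*-Solver
  interchange : ∀ a b c d → a * b * (c * d) ≡ a * c * (b * d)
  interchange = solve 4 (λ a b c d → a :* b :* (c :* d) := a :* c :* (b :* d)) refl

qpow-1ℚ : ∀ n → qpow 1ℚ n ≡ 1ℚ
qpow-1ℚ zero    = refl
qpow-1ℚ (suc n) = trans (ℚP.*-identityʳ _) (qpow-1ℚ n)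

two^n*half^n : ∀ n → qpow two n * qpow half n ≡ 1ℚ
two^n*half^n n = trans (sym (qpow-* two half n))
  (trans (cong (λ z → qpow z n) (trans (ℚP.*-comm two half) half*two)) (qpow-1ℚ n))

ι-2^ : ∀ j → ι (2 ^ j) ≡ qpow two j
ι-2^ zero    = refl
ι-2^ (suc j) = trans (ι-* 2 (2 ^ j)) (trans (cong (ι 2 *_) (ι-2^ j)) (ℚP.*-comm (ι 2) (qpow two j)))

qpow-nonneg : ∀ {x} n → 0ℚ ℚ.≤ x → 0ℚ ℚ.≤ qpow x n
qpow-nonneg zero    x≥0 = 0≤1
qpow-nonneg (suc n) x≥0 = *-nonneg (qpow-nonneg n x≥0) x≥0

qpow-mono : ∀ {x y} n → 0ℚ ℚ.≤ x → x ℚ.≤ y → qpow x n ℚ.≤ qpow y n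
qpow-mono zero    x≥0 x≤y = ℚP.≤-refl
qpow-mono (suc n) x≥0 x≤y = *-mono-≤-nonneg (qpow-nonneg n x≥0) x≥0 (qpow-mono n x≥0 x≤y) x≤y

qpow-≤1 : ∀ {x} n → 0ℚ ℚ.≤ x → x ℚ.≤ 1ℚ → qpow x n ℚ.≤ 1ℚ
qpow-≤1 {x} n x≥0 x≤1 = subst (qpow x n ℚ.≤_) (qpow-1ℚ n) (qpow-mono n x≥0 x≤1)

qpow-suc-≤ : ∀ {x} n → 0ℚ ℚ.≤ x → x ℚ.≤ 1ℚ → qpow x (suc n) ℚ.≤ x
qpow-suc-≤ {x} n x≥0 x≤1 = subst (qpow x (suc n) ℚ.≤_) (ℚP.*-identityˡ x)
  (*-mono-≤-nonneg (qpow-nonneg n x≥0) x≥0 (qpow-≤1 n x≥0 x≤1) ℚP.≤-refl)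

sgn : ℕ → ℚ
sgn i = qpow (- 1ℚ) i

∣sgn∣ : ∀ i → ∣ sgn i ∣ ≡ 1ℚ
∣sgn∣ zero    = refl
∣sgn∣ (suc i) = trans (ℚP.∣p*q∣≡∣p∣*∣q∣ (sgn i) (- 1ℚ)) (cong (_* 1ℚ) (∣sgn∣ i))

sgn-even : ∀ N → sgn (N ℕ.+ N) ≡ 1ℚ
sgn-even N = trans (qpow-+ (- 1ℚ) N N) (square N)
  where
  open +-*-Solver
  flip² : ∀ s → s * - 1ℚ * (s * - 1ℚ) ≡ s * s * 1ℚ
  flip² = solve 1 (λ s → s :* (:- con 1ℚ) :* (s :* (:- con 1ℚ)) := s :* s :* con 1ℚ) refl
  square : ∀ N → sgn N * sgn N ≡ 1ℚ
  square zero    = refl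
  square (suc N) = trans (flip² (sgn N)) (cong (_* 1ℚ) (square N))

C : ℕ → ℕ → ℚ
C n       zero    = 1ℚ
C zero    (suc i) = 0ℚ
C (suc n) (suc i) = C n i + C n (suc i)

C-vanish : ∀ n i → n ℕ.< i → C n i ≡ 0ℚ
C-vanish zero    (suc i) lt        = refl
C-vanish (suc n) (suc i) (s≤s lt) = cong₂ _+_ (C-vanish n i lt) (C-vanish n (suc i) (ℕP.m<n⇒m<1+n lt))

C-nonneg : ∀ n i → 0ℚ ℚ.≤ C n i
C-nonneg n       zero    = 0≤1
C-nonneg zero    (suc i) = ℚP.≤-refl
C-nonneg (suc n) (suc i) = ℚP.+-mono-≤ (C-nonneg n i) (C-nonneg n (suc i))

C-1 : ∀ m → C m 1 ≡ ι m
C-1 zero    = refl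
C-1 (suc m) = trans (cong (1ℚ +_) (C-1 m)) (ℚP.+-comm 1ℚ (ι m))

C-absorb : ∀ n i → ι (suc n) * C n i ≡ ι (suc i) * C (suc n) (suc i)
C-absorb zero    zero    = refl
C-absorb zero    (suc i) = trans (ℚP.*-zeroʳ (ι 1)) (sym (ℚP.*-zeroʳ (ι (suc (suc i)))))
C-absorb (suc n) zero    = trans (ℚP.*-identityʳ (ι (suc (suc n))))
  (sym (trans (ℚP.*-identityˡ (C (suc (suc n)) 1)) (C-1 (suc (suc n)))))
C-absorb (suc n) (suc i) = begin
    (x + 1ℚ + 1ℚ) * (a + b)
  ≡⟨ regroup x a b ⟩
    ((x + 1ℚ) * a + (a + b)) + (x + 1ℚ) * b
  ≡⟨ cong₂ (λ u v → (u + (a + b)) + v) (C-absorb n i) (C-absorb n (suc i)) ⟩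
    ((y + 1ℚ) * (a + b) + (a + b)) + (y + 1ℚ + 1ℚ) * c
  ≡⟨ collect y a b c ⟩
    (y + 1ℚ + 1ℚ) * ((a + b) + c)
  ∎
  where
  open ≡-Reasoning
  open +-*-Solver
  x = ι n
  y = ι i
  a = C n i
  b = C n (suc i)
  c = C (suc n) (suc (suc i))
  regroup : ∀ x a b → (x + 1ℚ + 1ℚ) * (a + b) ≡ ((x + 1ℚ) * a + (a + b)) + (x + 1ℚ) * b
  regroup = solve 3 (λ x a b → (x :+ con 1ℚ :+ con 1ℚ) :* (a :+ b)
                             := ((x :+ con 1ℚ) :* a :+ (a :+ b)) :+ (x :+ con 1ℚ) :* b) refl
  collect : ∀ y a b c → ((y + 1ℚ) * (a + b) + (a + b)) + (y + 1ℚ + 1ℚ) * c ≡ (y + 1ℚ + 1ℚ) * ((a + b) + c)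
  collect = solve 4 (λ y a b c → ((y :+ con 1ℚ) :* (a :+ b) :+ (a :+ b)) :+ (y :+ con 1ℚ :+ con 1ℚ) :* c
                               := (y :+ con 1ℚ :+ con 1ℚ) :* ((a :+ b) :+ c)) refl

cross-divide : ∀ r s p q c d → r * p ≡ 1ℚ → s * q ≡ 1ℚ → p * c ≡ q * d → r * d ≡ s * c
cross-divide r s p q c d rp sq pc≡qd = begin
    r * d
  ≡⟨ sym (ℚP.*-identityʳ _) ⟩
    r * d * 1ℚ
  ≡⟨ cong (r * d *_) (sym sq) ⟩
    r * d * (s * q)
  ≡⟨ shuffle₁ r d s q ⟩
    r * s * (q * d)
  ≡⟨ cong (r * s *_) (sym pc≡qd) ⟩
    r * s * (p * c)
  ≡⟨ shuffle₂ r s p c ⟩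
    s * c * (r * p)
  ≡⟨ cong (s * c *_) rp ⟩
    s * c * 1ℚ
  ≡⟨ ℚP.*-identityʳ _ ⟩
    s * c
  ∎
  where
  open ≡-Reasoning
  open +-*-Solver
  shuffle₁ : ∀ a b c d → a * b * (c * d) ≡ a * c * (d * b)
  shuffle₁ = solve 4 (λ a b c d → a :* b :* (c :* d) := a :* c :* (d :* b)) refl
  shuffle₂ : ∀ a b c d → a * b * (c * d) ≡ b * d * (a * c)
  shuffle₂ = solve 4 (λ a b c d → a :* b :* (c :* d) := b :* d :* (a :* c)) refl

C-absorb-recip : ∀ n i → recip (suc n) * C (suc n) (suc i) ≡ recip (suc i) * C n i
C-absorb-recip n i = cross-divide (recip (suc n)) (recip (suc i)) (ι (suc n)) (ι (suc i))
  (C n i) (C (suc n) (suc i)) (recip-inverse n) (recip-inverse i) (C-absorb n i)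

∑-pascal : ∀ n (u : ℕ → ℚ) → ∑ (suc n) (λ i → C (suc n) (suc i) * u i)
         ≡ ∑ (suc n) (λ i → C n i * u i) + ∑ n (λ i → C n (suc i) * u i)
∑-pascal n u = begin
    ∑ (suc n) (λ i → (C n i + C n (suc i)) * u i)
  ≡⟨ ∑-cong (suc n) (λ i → ℚP.*-distribʳ-+ (u i) (C n i) (C n (suc i))) ⟩
    ∑ (suc n) (λ i → C n i * u i + C n (suc i) * u i)
  ≡⟨ ∑-+ (suc n) (λ i → C n i * u i) (λ i → C n (suc i) * u i) ⟩
    L + (R + C n (suc n) * u n)
  ≡⟨ cong (λ z → L + (R + z * u n)) (C-vanish n (suc n) ℕP.≤-refl) ⟩
    L + (R + 0ℚ * u n)
  ≡⟨ cong (λ z → L + (R + z)) (ℚP.*-zeroˡ (u n)) ⟩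
    L + (R + 0ℚ)
  ≡⟨ cong (L +_) (ℚP.+-identityʳ R) ⟩
    L + R
  ∎
  where
  open ≡-Reasoning
  L = ∑ (suc n) (λ i → C n i * u i)
  R = ∑ n (λ i → C n (suc i) * u i)

C-row-sum : ∀ n → ∑ (suc n) (C n) ≡ qpow two n
C-row-sum zero    = refl
C-row-sum (suc n) = begin
    ∑ (suc (suc n)) (C (suc n))
  ≡⟨ ∑-first (suc n) (C (suc n)) ⟩
    1ℚ + ∑ (suc n) (λ i → C (suc n) (suc i))
  ≡⟨ cong (1ℚ +_) (∑-cong (suc n) (λ i → sym (ℚP.*-identityʳ _))) ⟩
    1ℚ + ∑ (suc n) (λ i → C (suc n) (suc i) * 1ℚ)
  ≡⟨ cong (1ℚ +_) (∑-pascal n (λ _ → 1ℚ)) ⟩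
    1ℚ + (∑ (suc n) (λ i → C n i * 1ℚ) + ∑ n (λ i → C n (suc i) * 1ℚ))
  ≡⟨ cong₂ (λ u v → 1ℚ + (u + v)) (∑-cong (suc n) (λ i → ℚP.*-identityʳ _)) (∑-cong n (λ i → ℚP.*-identityʳ _)) ⟩
    1ℚ + (∑ (suc n) (C n) + Z)
  ≡⟨ cong (λ z → 1ℚ + (z + Z)) (∑-first n (C n)) ⟩
    1ℚ + ((1ℚ + Z) + Z)
  ≡⟨ double Z ⟩
    (1ℚ + Z) * two
  ≡⟨ cong (_* two) (trans (sym (∑-first n (C n))) (C-row-sum n)) ⟩
    qpow two n * two
  ∎
  where
  open ≡-Reasoning
  open +-*-Solver
  Z = ∑ n (λ i → C n (suc i))
  double : ∀ z → 1ℚ + ((1ℚ + z) + z) ≡ (1ℚ + z) * two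
  double = solve 1 (λ z → con 1ℚ :+ ((con 1ℚ :+ z) :+ z) := (con 1ℚ :+ z) :* (con 1ℚ :+ con 1ℚ)) refl

-- Σ_{i≤N} C(N,i)/(i+1) = (2^(N+1) - 1)/(N+1) ≤ 2^N·2/(N+1).
∑-C*recip≤ : ∀ N → ∑ (suc N) (λ i → C N i * recip (suc i)) ℚ.≤ recip (suc N) * (qpow two N * two)
∑-C*recip≤ N = begin
    ∑ (suc N) (λ i → C N i * recip (suc i))
  ≡⟨ ∑-cong (suc N) (λ i → trans (ℚP.*-comm (C N i) _) (sym (C-absorb-recip N i))) ⟩
    ∑ (suc N) (λ i → recip (suc N) * C (suc N) (suc i))
  ≡⟨ sym (∑-*ˡ (suc N) (recip (suc N)) _) ⟩
    recip (suc N) * ∑ (suc N) (λ i → C (suc N) (suc i))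
  ≤⟨ ℚP.*-monoˡ-≤-nonNeg (recip (suc N)) {{ℚ.nonNegative (recip-nonneg (suc N))}} row-tail ⟩
    recip (suc N) * (qpow two N * two)
  ∎
  where
  open ℚP.≤-Reasoning
  row-tail : ∑ (suc N) (λ i → C (suc N) (suc i)) ℚ.≤ qpow two N * two
  row-tail = subst (∑ (suc N) (λ i → C (suc N) (suc i)) ℚ.≤_)
    (trans (sym (∑-first (suc N) (C (suc N)))) (C-row-sum (suc N))) (p≤q+p 1ℚ 0≤1)

module EulerTransform (α : ℕ → ℚ) where

  A : ℕ → ℚ
  A N = ∑ N α

  b : ℕ → ℚ
  b m = ∑ (suc m) (λ i → C m i * α i)

  B : ℕ → ℚ
  B N = ∑ N (λ m → b m * qpow half (suc m))

  V : ℕ → ℚ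
  V N = ∑ (suc N) (λ i → C N i * A i)

  V-step : ∀ N → V (suc N) ≡ two * V N + b N
  V-step N = begin
      V (suc N)
    ≡⟨ ∑-first (suc N) (λ i → C (suc N) i * A i) ⟩
      1ℚ * 0ℚ + ∑ (suc N) (λ i → C (suc N) (suc i) * A (suc i))
    ≡⟨ cong (1ℚ * 0ℚ +_) (∑-pascal N (λ i → A (suc i))) ⟩
      1ℚ * 0ℚ + (∑ (suc N) (λ i → C N i * (A i + α i)) + ∑ N (λ i → C N (suc i) * A (suc i)))
    ≡⟨ cong₂ (λ u v → 1ℚ * 0ℚ + (u + v)) split-terms shift-index ⟩
      1ℚ * 0ℚ + ((V N + b N) + V N)
    ≡⟨ collect (V N) (b N) ⟩
      two * V N + b N
    ∎
    where
    open ≡-Reasoning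
    open +-*-Solver
    collect : ∀ v c → 1ℚ * 0ℚ + ((v + c) + v) ≡ (1ℚ + 1ℚ) * v + c
    collect = solve 2 (λ v c → con 1ℚ :* con 0ℚ :+ ((v :+ c) :+ v) := (con 1ℚ :+ con 1ℚ) :* v :+ c) refl
    split-terms : ∑ (suc N) (λ i → C N i * (A i + α i)) ≡ V N + b N
    split-terms = trans (∑-cong (suc N) (λ i → ℚP.*-distribˡ-+ (C N i) (A i) (α i))) (∑-+ (suc N) _ _)
    drop-zero : ∀ x → 1ℚ * 0ℚ + x ≡ x
    drop-zero = solve 1 (λ x → con 1ℚ :* con 0ℚ :+ x := x) refl
    shift-index : ∑ N (λ i → C N (suc i) * A (suc i)) ≡ V N
    shift-index = sym (trans (∑-first N (λ i → C N i * A i)) (drop-zero _))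

  -- Both sides satisfy X (N+1) = 2 X N + b N.
  2^N*B≡V : ∀ N → qpow two N * B N ≡ V N
  2^N*B≡V zero    = refl
  2^N*B≡V (suc N) = begin
      (P * two) * (B N + b N * (Q * half))
    ≡⟨ expand P Q (B N) (b N) ⟩
      two * (P * B N) + (P * Q) * (half * two) * b N
    ≡⟨ cong₂ (λ u v → two * u + v * (half * two) * b N) (2^N*B≡V N) (two^n*half^n N) ⟩
      two * V N + 1ℚ * 1ℚ * b N
    ≡⟨ cong (two * V N +_) (ℚP.*-identityˡ (b N)) ⟩
      two * V N + b N
    ≡⟨ sym (V-step N) ⟩
      V (suc N)
    ∎
    where
    open ≡-Reasoning
    open +-*-Solver
    P = qpow two N
    Q = qpow half N
    expand : ∀ P Q x c → (P * two) * (x + c * (Q * half)) ≡ two * (P * x) + (P * Q) * (half * two) * c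
    expand = solve 4 (λ P Q x c → (P :* (con 1ℚ :+ con 1ℚ)) :* (x :+ c :* (Q :* con half)) :=
               (con 1ℚ :+ con 1ℚ) :* (P :* x) :+ (P :* Q) :* (con half :* (con 1ℚ :+ con 1ℚ)) :* c) refl

  error-identity : ∀ N → qpow two N * (A N - B N) ≡ ∑ (suc N) (λ i → C N i * (A N - A i))
  error-identity N = sym (begin
      ∑ (suc N) (λ i → C N i * (A N - A i))
    ≡⟨ ∑-cong (suc N) (λ i → distrib (C N i) (A N) (A i)) ⟩
      ∑ (suc N) (λ i → C N i * A N + - (C N i * A i))
    ≡⟨ ∑-+ (suc N) _ _ ⟩
      ∑ (suc N) (λ i → C N i * A N) + ∑ (suc N) (λ i → - (C N i * A i))
    ≡⟨ cong₂ _+_ (sym (∑-*ʳ (suc N) (A N) (C N))) (∑-neg (suc N) _) ⟩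
      ∑ (suc N) (C N) * A N + - V N
    ≡⟨ cong₂ (λ u v → u * A N + - v) (C-row-sum N) (sym (2^N*B≡V N)) ⟩
      qpow two N * A N + - (qpow two N * B N)
    ≡⟨ sym (distrib (qpow two N) (A N) (B N)) ⟩
      qpow two N * (A N - B N)
    ∎)
    where
    open ≡-Reasoning
    open +-*-Solver
    distrib : ∀ c x y → c * (x - y) ≡ c * x + - (c * y)
    distrib = solve 3 (λ c x y → c :* (x :- y) := c :* x :+ :- (c :* y)) refl

  error-bound : (∀ i n → i ℕ.≤ n → ∣ A n - A i ∣ ℚ.≤ recip (suc i)) →
                ∀ N → ∣ A N - B N ∣ ℚ.≤ two * recip (suc N)
  error-bound tail N = begin
      ∣ A N - B N ∣
    ≡⟨ cong ∣_∣ (sym unscale) ⟩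
      ∣ Q * (P * (A N - B N)) ∣
    ≤⟨ ∣c*x∣≤c*bound (qpow-nonneg N (recip-nonneg 2)) weighted ⟩
      Q * (r * (P * two))
    ≡⟨ regroup Q P r ⟩
      (P * Q) * (two * r)
    ≡⟨ cong (_* (two * r)) (two^n*half^n N) ⟩
      1ℚ * (two * r)
    ≡⟨ ℚP.*-identityˡ _ ⟩
      two * r
    ∎
    where
    open ℚP.≤-Reasoning
    open +-*-Solver
    P = qpow two N
    Q = qpow half N
    r = recip (suc N)
    regroup : ∀ q p r → q * (r * (p * (1ℚ + 1ℚ))) ≡ (p * q) * ((1ℚ + 1ℚ) * r)
    regroup = solve 3 (λ q p r → q :* (r :* (p :* (con 1ℚ :+ con 1ℚ))) := (p :* q) :* ((con 1ℚ :+ con 1ℚ) :* r)) refl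
    reassociate : ∀ q p x → q * (p * x) ≡ (p * q) * x
    reassociate = solve 3 (λ q p x → q :* (p :* x) := (p :* q) :* x) refl
    unscale : Q * (P * (A N - B N)) ≡ A N - B N
    unscale = trans (reassociate Q P _) (trans (cong (_* (A N - B N)) (two^n*half^n N)) (ℚP.*-identityˡ _))
    termwise : ∀ i → i ℕ.< suc N → ∣ C N i * (A N - A i) ∣ ℚ.≤ C N i * recip (suc i)
    termwise i (s≤s i≤N) = ∣c*x∣≤c*bound (C-nonneg N i) (tail i N i≤N)
    weighted : ∣ P * (A N - B N) ∣ ℚ.≤ r * (P * two)
    weighted = begin
        ∣ P * (A N - B N) ∣
      ≡⟨ cong ∣_∣ (error-identity N) ⟩
        ∣ ∑ (suc N) (λ i → C N i * (A N - A i)) ∣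
      ≤⟨ ∣∑∣≤∑∣∣ (suc N) _ ⟩
        ∑ (suc N) (λ i → ∣ C N i * (A N - A i) ∣)
      ≤⟨ ∑-mono (suc N) termwise ⟩
        ∑ (suc N) (λ i → C N i * recip (suc i))
      ≤⟨ ∑-C*recip≤ N ⟩
        r * (P * two)
      ∎

open EulerTransform using (A; b; B)

β : ℕ → ℕ → ℚ
β k j = qpow (recip (suc j)) k

α : ℕ → ℕ → ℚ
α k i = sgn i * β k i

β-nonneg : ∀ k j → 0ℚ ℚ.≤ β k j
β-nonneg k j = qpow-nonneg k (recip-nonneg (suc j))

β-antitone : ∀ k i j → i ℕ.≤ j → β k j ℚ.≤ β k i
β-antitone k i j le = qpow-mono k (recip-nonneg (suc j)) (recip-antitone i j le)

altPartial≡A : ∀ k N → altPartial k N ≡ A (α k) N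
altPartial≡A k N = sum1≡∑ N _

zetaPartial≡∑β : ∀ k N → zetaPartial k N ≡ ∑ N (β k)
zetaPartial≡∑β k N = sum1≡∑ N _

-- Binomial form of the harmonic numbers:
--   H_n^(k) = T k n = Σ_{i<n} C(n,i+1) (-1)^i/(i+1)^k   (n ≥ 1).

T : ℕ → ℕ → ℚ
T k n = ∑ n (λ i → C n (suc i) * α k i)

-- Dividing T k (m+1) by m+1 gives the binomial transform of α (k+1),
-- by absorption C(m+1,i+1)/(m+1) = C(m,i)/(i+1).
T/succ≡b : ∀ k m → T k (suc m) * recip (suc m) ≡ b (α (suc k)) m
T/succ≡b k m = trans (∑-*ʳ (suc m) (recip (suc m)) _) (∑-cong (suc m) divide-term)
  where
  open ≡-Reasoning
  open +-*-Solver
  divide-term : ∀ i → C (suc m) (suc i) * α k i * recip (suc m) ≡ C m i * α (suc k) i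
  divide-term i = begin
      C (suc m) (suc i) * (sgn i * β k i) * recip (suc m)
    ≡⟨ move (C (suc m) (suc i)) (sgn i) (β k i) (recip (suc m)) ⟩
      (recip (suc m) * C (suc m) (suc i)) * (sgn i * β k i)
    ≡⟨ cong (_* (sgn i * β k i)) (C-absorb-recip m i) ⟩
      (recip (suc i) * C m i) * (sgn i * β k i)
    ≡⟨ move-back (recip (suc i)) (C m i) (sgn i) (β k i) ⟩
      C m i * (sgn i * (β k i * recip (suc i)))
    ∎
    where
    move : ∀ c s p r → c * (s * p) * r ≡ (r * c) * (s * p)
    move = solve 4 (λ c s p r → c :* (s :* p) :* r := (r :* c) :* (s :* p)) refl
    move-back : ∀ r c s p → (r * c) * (s * p) ≡ c * (s * (p * r))
    move-back = solve 4 (λ r c s p → (r :* c) :* (s :* p) := c :* (s :* (p :* r))) refl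

-- Pascal's rule makes T satisfy the recursion defining H.
T-step : ∀ k n → T (suc k) (suc n) ≡ T (suc k) n + T k (suc n) * recip (suc n)
T-step k n = begin
    T (suc k) (suc n)
  ≡⟨ ∑-pascal n (α (suc k)) ⟩
    b (α (suc k)) n + T (suc k) n
  ≡⟨ ℚP.+-comm (b (α (suc k)) n) (T (suc k) n) ⟩
    T (suc k) n + b (α (suc k)) n
  ≡⟨ cong (T (suc k) n +_) (sym (T/succ≡b k n)) ⟩
    T (suc k) n + T k (suc n) * recip (suc n)
  ∎
  where open ≡-Reasoning

-- Σ_{i≤n} (-1)^i C(n+1,i+1) = 1, by Pascal's rule and telescoping.
T-zero : ∀ n → T 0 (suc n) ≡ 1ℚ
T-zero n = begin
    T 0 (suc n)
  ≡⟨ ∑-pascal n (α 0) ⟩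
    ∑ (suc n) (λ i → C n i * α 0 i) + T 0 n
  ≡⟨ cong (_+ T 0 n) (∑-first n (λ i → C n i * α 0 i)) ⟩
    (1ℚ * (1ℚ * 1ℚ) + ∑ n (λ i → C n (suc i) * α 0 (suc i))) + T 0 n
  ≡⟨ cong (λ z → (1ℚ * (1ℚ * 1ℚ) + z) + T 0 n) (trans (∑-cong n (λ i → flip (C n (suc i)) (sgn i))) (∑-neg n _)) ⟩
    (1ℚ * (1ℚ * 1ℚ) + - T 0 n) + T 0 n
  ≡⟨ cancel (T 0 n) ⟩
    1ℚ
  ∎
  where
  open ≡-Reasoning
  open +-*-Solver
  flip : ∀ c s → c * (s * - 1ℚ * 1ℚ) ≡ - (c * (s * 1ℚ))
  flip = solve 2 (λ c s → c :* (s :* (:- con 1ℚ) :* con 1ℚ) := :- (c :* (s :* con 1ℚ))) refl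
  cancel : ∀ t → (1ℚ * (1ℚ * 1ℚ) + - t) + t ≡ 1ℚ
  cancel = solve 1 (λ t → (con 1ℚ :* (con 1ℚ :* con 1ℚ) :+ :- t) :+ t := con 1ℚ) refl

mutual
  H≡T : ∀ k n → H k (suc n) ≡ T k (suc n)
  H≡T zero    n = sym (T-zero n)
  H≡T (suc k) n = H-suc≡T k (suc n)

  H-suc≡T : ∀ k n → H (suc k) n ≡ T (suc k) n
  H-suc≡T k zero    = refl
  H-suc≡T k (suc n) = trans (cong₂ (λ x y → x + y * recip (suc n)) (H-suc≡T k n) (H≡T k n)) (sym (T-step k n))

hPartial≡B : ∀ k N → hPartial (suc k) N ≡ B (α (suc k)) N
hPartial≡B k N = trans (sum1≡∑ N _) (∑-cong N (λ m → cong (_* qpow half (suc m))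
  (trans (cong (_* recip (suc m)) (H≡T k m)) (T/succ≡b k m))))

alternating-bound : ∀ d (u : ℕ → ℚ) → (∀ t → 0ℚ ℚ.≤ u t) → (∀ t → u (suc t) ℚ.≤ u t) →
                    (0ℚ ℚ.≤ ∑ d (λ t → sgn t * u t)) × (∑ d (λ t → sgn t * u t) ℚ.≤ u 0)
alternating-bound zero    u u≥0 u↓ = ℚP.≤-refl , u≥0 0
alternating-bound (suc d) u u≥0 u↓ = lower , upper
  where
  rest = ∑ d (λ t → sgn t * u (suc t))
  ih = alternating-bound d (λ t → u (suc t)) (λ t → u≥0 (suc t)) (λ t → u↓ (suc t))
  open +-*-Solver
  flip : ∀ s x → s * - 1ℚ * x ≡ - (s * x)
  flip = solve 2 (λ s x → s :* (:- con 1ℚ) :* x := :- (s :* x)) refl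
  peel : ∑ (suc d) (λ t → sgn t * u t) ≡ u 0 - rest
  peel = trans (∑-first d (λ t → sgn t * u t))
    (cong₂ _+_ (ℚP.*-identityˡ (u 0)) (trans (∑-cong d (λ t → flip (sgn t) (u (suc t)))) (∑-neg d _)))
  lower : 0ℚ ℚ.≤ ∑ (suc d) (λ t → sgn t * u t)
  lower = subst (0ℚ ℚ.≤_) (sym peel) (0≤q-p (ℚP.≤-trans (proj₂ ih) (u↓ 0)))
  upper : ∑ (suc d) (λ t → sgn t * u t) ℚ.≤ u 0
  upper = subst (ℚ._≤ u 0) (sym peel) (q-p≤q (u 0) (proj₁ ih))

tail-from-increments : (F g : ℕ → ℚ) → (∀ i d → ∣ F (i ℕ.+ d) - F i ∣ ℚ.≤ g i) →
                       ∀ i n → i ℕ.≤ n → ∣ F n - F i ∣ ℚ.≤ g i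
tail-from-increments F g bound i n i≤n =
  subst (λ m → ∣ F m - F i ∣ ℚ.≤ g i) (ℕP.m+[n∸m]≡n i≤n) (bound i (n ∸ i))

alternating-tail : ∀ k i n → i ℕ.≤ n → ∣ A (α (suc k)) n - A (α (suc k)) i ∣ ℚ.≤ recip (suc i)
alternating-tail k = tail-from-increments (A (α K)) (λ i → recip (suc i)) increment
  where
  K = suc k
  open +-*-Solver
  reassoc : ∀ s t x → s * t * x ≡ s * (t * x)
  reassoc = solve 3 (λ s t x → s :* t :* x := s :* (t :* x)) refl
  increment : ∀ i d → ∣ A (α K) (i ℕ.+ d) - A (α K) i ∣ ℚ.≤ recip (suc i)
  increment i d = begin
      ∣ A (α K) (i ℕ.+ d) - A (α K) i ∣
    ≡⟨ cong ∣_∣ factor-sign ⟩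
      ∣ sgn i * Y ∣
    ≡⟨ ℚP.∣p*q∣≡∣p∣*∣q∣ (sgn i) Y ⟩
      ∣ sgn i ∣ * ∣ Y ∣
    ≡⟨ cong₂ _*_ (∣sgn∣ i) (ℚP.0≤p⇒∣p∣≡p (proj₁ leibniz)) ⟩
      1ℚ * Y
    ≡⟨ ℚP.*-identityˡ Y ⟩
      Y
    ≤⟨ proj₂ leibniz ⟩
      β K (i ℕ.+ 0)
    ≡⟨ cong (β K) (ℕP.+-identityʳ i) ⟩
      β K i
    ≤⟨ qpow-suc-≤ k (recip-nonneg (suc i)) (recip-≤1 i) ⟩
      recip (suc i)
    ∎
    where
    open ℚP.≤-Reasoning
    Y = ∑ d (λ t → sgn t * β K (i ℕ.+ t))
    leibniz = alternating-bound d (λ t → β K (i ℕ.+ t)) (λ t → β-nonneg K (i ℕ.+ t))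
                (λ t → β-antitone K (i ℕ.+ t) (i ℕ.+ suc t) (ℕP.+-monoʳ-≤ i (ℕP.n≤1+n t)))
    factor-sign : A (α K) (i ℕ.+ d) - A (α K) i ≡ sgn i * Y
    factor-sign = trans (∑-increment i d (α K))
      (trans (∑-cong d (λ t → trans (cong (_* β K (i ℕ.+ t)) (qpow-+ (- 1ℚ) i t)) (reassoc (sgn i) (sgn t) _)))
             (sym (∑-*ˡ d (sgn i) _)))

distance-from-tail : (F g : ℕ → ℚ) → (∀ i n → i ℕ.≤ n → ∣ F n - F i ∣ ℚ.≤ g i) →
                     (∀ i j → i ℕ.≤ j → g j ℚ.≤ g i) →
                     ∀ N m n → N ℕ.≤ m → N ℕ.≤ n → ∣ F m - F n ∣ ℚ.≤ g N
distance-from-tail F g tail g↓ N m n N≤m N≤n with ℕP.≤-total n m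
... | inj₁ n≤m = ℚP.≤-trans (tail n m n≤m) (g↓ N n N≤n)
... | inj₂ m≤n = ℚP.≤-trans (subst (ℚ._≤ g m) (∣p-q∣≡∣q-p∣ (F n) (F m)) (tail m n m≤n)) (g↓ N m N≤m)

-- Archimedes: c/(N+1) < ε for N = c·(denominator of ε).
archimedes : ∀ c ε → 0ℚ < ε → ∃[ N ] (ι c * recip (suc N) < ε)
archimedes c (mkℚ (ℤ.+ zero) d _)    (ℚ.*<* (ℤ.+<+ ()))
archimedes c (mkℚ ℤ.-[1+ p ] d _)    (ℚ.*<* ())
archimedes c ε@(mkℚ (ℤ.+ (suc p)) d _) _ =
  c ℕ.* suc d , subst (ι c * recip (suc (c ℕ.* suc d)) <_) numerator/denominator
    (fraction-< c (suc p) (c ℕ.* suc d) d (s≤s (ℕP.m≤m+n (c ℕ.* suc d) _)))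
  where
  numerator/denominator : ι (suc p) * recip (suc d) ≡ ε
  numerator/denominator = trans (sym (/≡ι*recip (suc p) d)) (ℚP.↥p/↧p≡p ε)

sameLimit-from-rate : ∀ (a b : ℕ → ℚ) c →
  (∀ N m n → N ℕ.≤ m → N ℕ.≤ n → ∣ a m - b n ∣ ℚ.≤ ι c * recip (suc N)) → SameLimit a b
sameLimit-from-rate a b c rate ε ε>0 with archimedes c ε ε>0
... | N , small = N , λ m n N≤m N≤n → ℚP.≤-<-trans (rate N m n N≤m N≤n) small

∣a-c∣≤∣a-b∣+∣b-c∣ : ∀ a b c → ∣ a - c ∣ ℚ.≤ ∣ a - b ∣ + ∣ b - c ∣
∣a-c∣≤∣a-b∣+∣b-c∣ a b c = subst (λ z → ∣ z ∣ ℚ.≤ ∣ a - b ∣ + ∣ b - c ∣) (chain a b c) (ℚP.∣p+q∣≤∣p∣+∣q∣ (a - b) (b - c))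
  where
  open +-*-Solver
  chain : ∀ a b c → (a - b) + (b - c) ≡ a - c
  chain = solve 3 (λ a b c → (a :- b) :+ (b :- c) := a :- c) refl

alternating-distance : ∀ k N m n → N ℕ.≤ m → N ℕ.≤ n →
                       ∣ A (α (suc k)) m - A (α (suc k)) n ∣ ℚ.≤ recip (suc N)
alternating-distance k = distance-from-tail (A (α (suc k))) (λ i → recip (suc i)) (alternating-tail k) recip-antitone

transform-error : ∀ k N n → N ℕ.≤ n → ∣ A (α (suc k)) n - B (α (suc k)) n ∣ ℚ.≤ two * recip (suc N)
transform-error k N n N≤n = ℚP.≤-trans (EulerTransform.error-bound (α (suc k)) (alternating-tail k) n)
  (ℚP.*-monoˡ-≤-nonNeg two {{ℚ.nonNegative (ι-nonneg 2)}} (recip-antitone N n N≤n))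

alternating-vs-transform : ∀ k N m n → N ℕ.≤ m → N ℕ.≤ n →
                           ∣ A (α (suc k)) m - B (α (suc k)) n ∣ ℚ.≤ ι 3 * recip (suc N)
alternating-vs-transform k N m n N≤m N≤n = begin
    ∣ A α' m - B α' n ∣
  ≤⟨ ∣a-c∣≤∣a-b∣+∣b-c∣ (A α' m) (A α' n) (B α' n) ⟩
    ∣ A α' m - A α' n ∣ + ∣ A α' n - B α' n ∣
  ≤⟨ ℚP.+-mono-≤ (alternating-distance k N m n N≤m N≤n) (transform-error k N n N≤n) ⟩
    r + two * r
  ≡⟨ triple r ⟩
    ι 3 * r
  ∎
  where
  open ℚP.≤-Reasoning
  open +-*-Solver
  α' = α (suc k)
  r = recip (suc N)
  triple : ∀ r → r + (1ℚ + 1ℚ) * r ≡ ι 3 * r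
  triple = solve 1 (λ r → r :+ (con 1ℚ :+ con 1ℚ) :* r := con (ι 3) :* r) refl

recip-double : ∀ N → recip (suc (suc (N ℕ.+ N))) ≡ half * recip (suc N)
recip-double N = sym (begin
    half * x
  ≡⟨ sym (ℚP.*-identityʳ _) ⟩
    half * x * 1ℚ
  ≡⟨ cong (half * x *_) (sym (recip-inverse (suc (N ℕ.+ N)))) ⟩
    half * x * (y * ι (suc (suc (N ℕ.+ N))))
  ≡⟨ cong (λ z → half * x * (y * z)) ι-double ⟩
    half * x * (y * (two * p))
  ≡⟨ regroup half x y p ⟩
    y * (half * two) * (x * p)
  ≡⟨ cong₂ (λ u v → y * u * v) half*two (recip-inverse N) ⟩
    y * 1ℚ * 1ℚ
  ≡⟨ trans (ℚP.*-identityʳ _) (ℚP.*-identityʳ y) ⟩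
    y
  ∎)
  where
  open ≡-Reasoning
  open +-*-Solver
  x = recip (suc N)
  p = ι (suc N)
  y = recip (suc (suc (N ℕ.+ N)))
  double : ∀ x → x + x + 1ℚ + 1ℚ ≡ (1ℚ + 1ℚ) * (x + 1ℚ)
  double = solve 1 (λ x → x :+ x :+ con 1ℚ :+ con 1ℚ := (con 1ℚ :+ con 1ℚ) :* (x :+ con 1ℚ)) refl
  ι-double : ι (suc (suc (N ℕ.+ N))) ≡ two * p
  ι-double = trans (cong (λ z → z + 1ℚ + 1ℚ) (ι-+ N N)) (double (ι N))
  regroup : ∀ h x y p → h * x * (y * ((1ℚ + 1ℚ) * p)) ≡ y * (h * (1ℚ + 1ℚ)) * (x * p)
  regroup = solve 4 (λ h x y p → h :* x :* (y :* ((con 1ℚ :+ con 1ℚ) :* p))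
                              := y :* (h :* (con 1ℚ :+ con 1ℚ)) :* (x :* p)) refl

-- Doubling: the even terms of ζ(k+1) sum to 2^(-(k+1)) Z N, so
--   Z (2N) = A (2N) + 2^(-k) Z N.
zeta-doubling : ∀ k N → ∑ (N ℕ.+ N) (β (suc k)) ≡ A (α (suc k)) (N ℕ.+ N) + qpow half k * ∑ N (β (suc k))
zeta-doubling k zero    = sym (trans (ℚP.+-identityˡ _) (ℚP.*-zeroʳ (qpow half k)))
zeta-doubling k (suc N) rewrite ℕP.+-suc N N = begin
    Z M + even + odd
  ≡⟨ cong (λ z → z + even + odd) (zeta-doubling k N) ⟩
    A' M + q * Z N + even + odd
  ≡⟨ cong (A' M + q * Z N + even +_) odd≡ ⟩
    A' M + q * Z N + even + q * half * last
  ≡⟨ regroup (A' M) q (Z N) even half last ⟩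
    A' M + 1ℚ * even + (1ℚ * - 1ℚ) * (q * half * last) + q * (Z N + (half * two) * last)
  ≡⟨ cong₂ (λ u v → A' M + u * even + (u * - 1ℚ) * v + q * (Z N + 1ℚ * last)) (sym (sgn-even N)) (sym odd≡) ⟩
    A' M + sgn M * even + (sgn M * - 1ℚ) * odd + q * (Z N + 1ℚ * last)
  ≡⟨ cong (λ z → A' M + sgn M * even + (sgn M * - 1ℚ) * odd + q * (Z N + z)) (ℚP.*-identityˡ last) ⟩
    A' M + sgn M * even + (sgn M * - 1ℚ) * odd + q * (Z N + last)
  ∎
  where
  open ≡-Reasoning
  open +-*-Solver
  K = suc k
  Z = λ n → ∑ n (β K)
  A' = A (α K)
  M = N ℕ.+ N
  q = qpow half k
  even = β K M
  odd = β K (suc M)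
  last = β K N
  odd≡ : odd ≡ q * half * last
  odd≡ = trans (cong (λ z → qpow z K) (recip-double N)) (qpow-* half (recip (suc N)) K)
  regroup : ∀ a q z e h l → a + q * z + e + q * h * l ≡
            a + 1ℚ * e + (1ℚ * - 1ℚ) * (q * h * l) + q * (z + (h * (1ℚ + 1ℚ)) * l)
  regroup = solve 6 (λ a q z e h l → a :+ q :* z :+ e :+ q :* h :* l :=
      a :+ con 1ℚ :* e :+ (con 1ℚ :* (:- con 1ℚ)) :* (q :* h :* l) :+ q :* (z :+ (h :* (con 1ℚ :+ con 1ℚ)) :* l)) refl

-- For k ≥ 2 the terms are dominated by a telescoping sequence:
--   1/(j+1)^k ≤ 1/(j+1)^2 ≤ 2 (1/(j+1) - 1/(j+2)).
β-telescoping-bound : ∀ k j → β (suc (suc k)) j ℚ.≤ two * (recip (suc j) - recip (suc (suc j)))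
β-telescoping-bound k j = begin
    qpow r (suc k) * r
  ≤⟨ *-mono-≤-nonneg (qpow-nonneg (suc k) r≥0) r≥0 (qpow-suc-≤ k r≥0 (recip-≤1 j)) ℚP.≤-refl ⟩
    r * r
  ≤⟨ ℚP.*-monoˡ-≤-nonNeg r {{ℚ.nonNegative r≥0}} r≤2r' ⟩
    r * (two * r')
  ≡⟨ swap r r' ⟩
    two * (r * r')
  ≡⟨ cong (two *_) (sym (recip-difference j)) ⟩
    two * (r - r')
  ∎
  where
  open ℚP.≤-Reasoning
  open +-*-Solver
  r = recip (suc j)
  r' = recip (suc (suc j))
  r≥0 = recip-nonneg (suc j)
  swap : ∀ r r' → r * ((1ℚ + 1ℚ) * r') ≡ (1ℚ + 1ℚ) * (r * r')
  swap = solve 2 (λ r r' → r :* ((con 1ℚ :+ con 1ℚ) :* r') := (con 1ℚ :+ con 1ℚ) :* (r :* r')) refl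
  r≤2r' : r ℚ.≤ two * r'
  r≤2r' = subst₂ ℚ._≤_ (sym (recip≡1*recip j)) refl
    (fraction-≤ 1 2 j (suc j) (s≤s (ℕP.m≤n+m (suc (j ℕ.+ 0)) j)))

zeta-tail : ∀ k i n → i ℕ.≤ n → ∣ ∑ n (β (suc (suc k))) - ∑ i (β (suc (suc k))) ∣ ℚ.≤ two * recip (suc i)
zeta-tail k = tail-from-increments (λ n → ∑ n (β K)) (λ i → two * recip (suc i)) increment
  where
  K = suc (suc k)
  increment : ∀ i d → ∣ ∑ (i ℕ.+ d) (β K) - ∑ i (β K) ∣ ℚ.≤ two * recip (suc i)
  increment i d = begin
      ∣ ∑ (i ℕ.+ d) (β K) - ∑ i (β K) ∣
    ≡⟨ cong ∣_∣ (∑-increment i d (β K)) ⟩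
      ∣ ∑ d (λ t → β K (i ℕ.+ t)) ∣
    ≡⟨ ℚP.0≤p⇒∣p∣≡p (∑-nonneg d _ (λ t → β-nonneg K (i ℕ.+ t))) ⟩
      ∑ d (λ t → β K (i ℕ.+ t))
    ≤⟨ ∑-mono d (λ t _ → subst (λ z → β K (i ℕ.+ t) ℚ.≤ two * (f t - recip (suc z)))
                                (sym (ℕP.+-suc i t)) (β-telescoping-bound k (i ℕ.+ t))) ⟩
      ∑ d (λ t → two * (f t - f (suc t)))
    ≡⟨ sym (∑-*ˡ d two _) ⟩
      two * ∑ d (λ t → f t - f (suc t))
    ≡⟨ cong (two *_) (∑-telescope d f) ⟩
      two * (f 0 - f d)
    ≤⟨ ℚP.*-monoˡ-≤-nonNeg two {{ℚ.nonNegative (ι-nonneg 2)}} (q-p≤q (f 0) (recip-nonneg (suc (i ℕ.+ d)))) ⟩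
      two * f 0
    ≡⟨ cong (λ z → two * recip (suc z)) (ℕP.+-identityʳ i) ⟩
      two * recip (suc i)
    ∎
    where
    open ℚP.≤-Reasoning
    f : ℕ → ℚ
    f t = recip (suc (i ℕ.+ t))

zeta-distance : ∀ k N m n → N ℕ.≤ m → N ℕ.≤ n →
                ∣ ∑ m (β (suc (suc k))) - ∑ n (β (suc (suc k))) ∣ ℚ.≤ two * recip (suc N)
zeta-distance k = distance-from-tail (λ n → ∑ n (β (suc (suc k)))) (λ i → two * recip (suc i)) (zeta-tail k)
  (λ i j i≤j → ℚP.*-monoˡ-≤-nonNeg two {{ℚ.nonNegative (ι-nonneg 2)}} (recip-antitone i j i≤j))

zetaConst-facts : ∀ k → (zetaConst (suc (suc k)) * (1ℚ - qpow half (suc k)) ≡ 1ℚ)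
                      × (0ℚ ℚ.≤ zetaConst (suc (suc k))) × (zetaConst (suc (suc k)) ℚ.≤ two)
zetaConst-facts k = inverse , nonneg , ≤two
  where
  M = 2 ^ suc k
  x = M ∸ 2
  x+2≡M : suc (suc x) ≡ M
  x+2≡M = ℕP.m+[n∸m]≡n (ℕP.*-monoʳ-≤ 2 (ℕP.m^n>0 2 k))
  c≡ : zetaConst (suc (suc k)) ≡ ι (suc (suc x)) * recip (suc x)
  c≡ = trans (/≡ι*recip M x) (cong (λ z → ι z * recip (suc x)) (sym x+2≡M))
  M*q≡1 : ι (suc (suc x)) * qpow half (suc k) ≡ 1ℚ
  M*q≡1 = trans (cong (λ z → ι z * qpow half (suc k)) x+2≡M)
    (trans (cong (_* qpow half (suc k)) (ι-2^ (suc k))) (two^n*half^n (suc k)))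
  open ≡-Reasoning
  open +-*-Solver
  expand : ∀ m r q → m * r * (1ℚ - q) ≡ r * (m - m * q)
  expand = solve 3 (λ m r q → m :* r :* (con 1ℚ :- q) := r :* (m :- m :* q)) refl
  pred : ∀ r n → r * ((n + 1ℚ) - 1ℚ) ≡ r * n
  pred = solve 2 (λ r n → r :* ((n :+ con 1ℚ) :- con 1ℚ) := r :* n) refl
  inverse = begin
      zetaConst (suc (suc k)) * (1ℚ - qpow half (suc k))
    ≡⟨ cong (_* (1ℚ - qpow half (suc k))) c≡ ⟩
      ι (suc (suc x)) * recip (suc x) * (1ℚ - qpow half (suc k))
    ≡⟨ expand (ι (suc (suc x))) (recip (suc x)) (qpow half (suc k)) ⟩
      recip (suc x) * ((ι (suc x) + 1ℚ) - ι (suc (suc x)) * qpow half (suc k))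
    ≡⟨ cong (λ z → recip (suc x) * ((ι (suc x) + 1ℚ) - z)) M*q≡1 ⟩
      recip (suc x) * ((ι (suc x) + 1ℚ) - 1ℚ)
    ≡⟨ pred (recip (suc x)) (ι (suc x)) ⟩
      recip (suc x) * ι (suc x)
    ≡⟨ recip-inverse x ⟩
      1ℚ
    ∎
  nonneg = subst (0ℚ ℚ.≤_) (sym c≡) (*-nonneg (ι-nonneg (suc (suc x))) (recip-nonneg (suc x)))
  cross-multiplied : ∀ y → suc (suc y) ℕ.* 1 ℕ.≤ 2 ℕ.* suc y
  cross-multiplied y rewrite ℕP.*-identityʳ (suc (suc y)) | ℕP.+-identityʳ y = s≤s (ℕP.m≤n+m (suc y) y)
  ≤two = subst (ℚ._≤ two) (sym c≡) (fraction-≤ (suc (suc x)) 2 x 0 (cross-multiplied x))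

zeta-error-decomposition : ∀ c q z z2 zn a2 a b → c * (1ℚ - q) ≡ 1ℚ → z2 ≡ a2 + q * zn →
  z - c * b ≡ c * ((z - z2) + q * (zn - z) + (a2 - a) + (a - b))
zeta-error-decomposition c q z z2 zn a2 a b c[1-q]≡1 doubling = sym (begin
    c * ((z - z2) + q * (zn - z) + (a2 - a) + (a - b))
  ≡⟨ cong (λ w → c * ((z - w) + q * (zn - z) + (a2 - a) + (a - b))) doubling ⟩
    c * ((z - (a2 + q * zn)) + q * (zn - z) + (a2 - a) + (a - b))
  ≡⟨ simplify c q z zn a2 a b ⟩
    c * (1ℚ - q) * z - c * b
  ≡⟨ cong (λ w → w * z - c * b) c[1-q]≡1 ⟩
    1ℚ * z - c * b
  ≡⟨ cong (_- c * b) (ℚP.*-identityˡ z) ⟩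
    z - c * b
  ∎)
  where
  open ≡-Reasoning
  open +-*-Solver
  simplify : ∀ c q z zn a2 a b → c * ((z - (a2 + q * zn)) + q * (zn - z) + (a2 - a) + (a - b)) ≡ c * (1ℚ - q) * z - c * b
  simplify = solve 7 (λ c q z zn a2 a b → c :* ((z :- (a2 :+ q :* zn)) :+ q :* (zn :- z) :+ (a2 :- a) :+ (a :- b)) :=
                        c :* (con 1ℚ :- q) :* z :- c :* b) refl

-- Part 2 with rate: for m, n ≥ N, |Z m - c B n| ≤ 2 (2 + 2 + 1 + 2)/(N+1).
zeta-vs-transform : ∀ k N m n → N ℕ.≤ m → N ℕ.≤ n →
  ∣ ∑ m (β (suc (suc k))) - zetaConst (suc (suc k)) * B (α (suc (suc k))) n ∣ ℚ.≤ ι 14 * recip (suc N)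
zeta-vs-transform k N m n N≤m N≤n = begin
    ∣ Z m - c * B α' n ∣
  ≡⟨ cong ∣_∣ (zeta-error-decomposition c q (Z m) (Z (n ℕ.+ n)) (Z n) (A α' (n ℕ.+ n)) (A α' n) (B α' n)
                 (proj₁ facts) (zeta-doubling (suc k) n)) ⟩
    ∣ c * X ∣
  ≡⟨ trans (ℚP.∣p*q∣≡∣p∣*∣q∣ c X) (cong (_* ∣ X ∣) (ℚP.0≤p⇒∣p∣≡p c≥0)) ⟩
    c * ∣ X ∣
  ≤⟨ *-mono-≤-nonneg c≥0 (ℚP.0≤∣p∣ X) (proj₂ (proj₂ facts)) X-bound ⟩
    two * (two * r + two * r + r + two * r)
  ≡⟨ fourteen r ⟩
    ι 14 * r
  ∎
  where
  open ℚP.≤-Reasoning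
  open +-*-Solver
  K = suc (suc k)
  Z = λ n → ∑ n (β K)
  α' = α K
  r = recip (suc N)
  q = qpow half (suc k)
  c = zetaConst K
  facts = zetaConst-facts k
  c≥0 = proj₁ (proj₂ facts)
  q≥0 : 0ℚ ℚ.≤ q
  q≥0 = qpow-nonneg (suc k) (recip-nonneg 2)
  N≤2n : N ℕ.≤ n ℕ.+ n
  N≤2n = ℕP.≤-trans N≤n (ℕP.m≤m+n n n)
  fourteen : ∀ r → (1ℚ + 1ℚ) * ((1ℚ + 1ℚ) * r + (1ℚ + 1ℚ) * r + r + (1ℚ + 1ℚ) * r) ≡ ι 14 * r
  fourteen = solve 1 (λ r → (con 1ℚ :+ con 1ℚ) :* ((con 1ℚ :+ con 1ℚ) :* r :+ (con 1ℚ :+ con 1ℚ) :* r :+ r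
                              :+ (con 1ℚ :+ con 1ℚ) :* r) := con (ι 14) :* r) refl
  X = (Z m - Z (n ℕ.+ n)) + q * (Z n - Z m) + (A α' (n ℕ.+ n) - A α' n) + (A α' n - B α' n)
  scaled : ∣ q * (Z n - Z m) ∣ ℚ.≤ two * r
  scaled = ℚP.≤-trans (∣c*x∣≤c*bound q≥0 (zeta-distance k N n m N≤n N≤m))
    (subst (q * (two * r) ℚ.≤_) (ℚP.*-identityˡ _)
      (ℚP.*-monoʳ-≤-nonNeg (two * r) {{ℚ.nonNegative (*-nonneg (ι-nonneg 2) (recip-nonneg (suc N)))}}
        (qpow-≤1 (suc k) (recip-nonneg 2) (recip-≤1 1))))
  X-bound : ∣ X ∣ ℚ.≤ two * r + two * r + r + two * r
  X-bound = ℚP.≤-trans (∣a+b+c+d∣≤ (Z m - Z (n ℕ.+ n)) (q * (Z n - Z m)) (A α' (n ℕ.+ n) - A α' n) (A α' n - B α' n))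
    (ℚP.+-mono-≤ (ℚP.+-mono-≤ (ℚP.+-mono-≤ (zeta-distance k N m (n ℕ.+ n) N≤m N≤2n) scaled)
       (alternating-distance (suc k) N (n ℕ.+ n) n N≤2n N≤n))
       (transform-error (suc k) N n N≤n))

theorem1 : ((k : ℕ) → 1 ≤ k → SameLimit (altPartial k) (hPartial k))
    × ((k : ℕ) → 2 ≤ k → SameLimit (zetaPartial k) (λ N → zetaConst k * hPartial k N))
theorem1 = part1 , part2
  where
  part1 : (k : ℕ) → 1 ≤ k → SameLimit (altPartial k) (hPartial k)
  part1 zero    ()
  part1 (suc k) _ = sameLimit-from-rate (altPartial (suc k)) (hPartial (suc k)) 3
    λ N m n N≤m N≤n → subst₂ (λ a b → ∣ a - b ∣ ℚ.≤ ι 3 * recip (suc N))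
      (sym (altPartial≡A (suc k) m)) (sym (hPartial≡B k n)) (alternating-vs-transform k N m n N≤m N≤n)
  part2 : (k : ℕ) → 2 ≤ k → SameLimit (zetaPartial k) (λ N → zetaConst k * hPartial k N)
  part2 (suc zero)    (s≤s ())
  part2 (suc (suc k)) _ = sameLimit-from-rate (zetaPartial (suc (suc k))) (λ N → zetaConst (suc (suc k)) * hPartial (suc (suc k)) N) 14
    λ N m n N≤m N≤n → subst₂ (λ a b → ∣ a - zetaConst (suc (suc k)) * b ∣ ℚ.≤ ι 14 * recip (suc N))
      (sym (zetaPartial≡∑β (suc (suc k)) m)) (sym (hPartial≡B (suc k) n)) (zeta-vs-transform k N m n N≤m N≤n)
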